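{- Let $I$ be a set of positive integers, let $\ell$ be a positive integer with $\ell\notin I$, let $i$ be an even positive integer, and let $\psi\in\mathcal L^+_A(I)$ be equivalent to $[A_\ell]^i p$. Then $|\psi|\ge 2^{i/2}$.
   Context: Bimodal Kripke models $M=(W,R_1,R_2,\Pi)$, pointed models $(M,w)$. For a word $s=s_1\dots s_l\in\{1,2\}^*$, $w'$ is an $s$-successor of $w$ if there are $w=w_0,\dots,w_l=w'$ with $(w_{k-1},w_k)\in R_{s_k}$. A language $L\subseteq\{1,2\}^*$ yields the operator $[L]$: $M,w\models[L]\varphi$ iff $M,w'\models\varphi$ for every $s$-successor $w'$ of $w$ with $s\in L$. For $\ell\ge1$, $a^\ell_1$ and $a^\ell_2$ are the words of length $\ell$ over $\{1,2\}$ in which consecutive letters differ, starting with $1$ resp. $2$, and $A_\ell=\{a^\ell_1,a^\ell_2\}$; $[A_\ell]^i$ denotes $i$-fold iteration of $[A_\ell]$. For a set $I$ of positive integers, $\mathcal L^+_A(I)$ is the logic with formulas $\varphi::=p\mid\neg\varphi\mid\varphi\vee\varphi\mid[A_k]\varphi\ (k\in I)\mid[\{1\}]\varphi\mid[\{2\}]\varphi$ (the last two are the ordinary boxes $\Box_1,\Box_2$). $|\psi|$ is the number of nodes of the syntax tree; formulas are equivalent if they hold at the same pointed models. -}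

module Defs where

open import Data.Nat using (ℕ; zero; suc; _+_)
open import Data.Bool using (Bool; true; false; not; _∧_; _∨_)
open import Data.Fin using (Fin)
open import Data.List using (List; []; _∷_; allFin)

data Letter : Set where
  one two : Letter

other : Letter → Letter
other one = two
other two = one

record Model (n : ℕ) : Set where
  field
    R₁ R₂ : Fin n → Fin n → Bool
    Π     : ℕ → Fin n → Bool

open Model public

rel : ∀ {n} → Model n → Letter → Fin n → Fin n → Bool
rel M one = R₁ M
rel M two = R₂ M

allB : ∀ {A : Set} → (A → Bool) → List A → Bool
allB f []       = true
allB f (x ∷ xs) = f x ∧ allB f xs

box : ∀ {n} → Model n → Letter → (Fin n → Bool) → Fin n → Bool
box {n} M a f w = allB (λ v → not (rel M a w v) ∨ f v) (allFin n)

boxWord : ∀ {n} → Model n → List Letter → (Fin n → Bool) → Fin n → Bool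
boxWord M []      f = f
boxWord M (a ∷ s) f = box M a (boxWord M s f)

alt : Letter → ℕ → List Letter
alt a zero    = []
alt a (suc k) = a ∷ alt (other a) k

boxA : ∀ {n} → Model n → ℕ → (Fin n → Bool) → Fin n → Bool
boxA M k f w = boxWord M (alt one k) f w ∧ boxWord M (alt two k) f w

iterA : ∀ {n} → Model n → ℕ → ℕ → (Fin n → Bool) → Fin n → Bool
iterA M ℓ zero    f = f
iterA M ℓ (suc i) f = boxA M ℓ (iterA M ℓ i f)

data Form (I : ℕ → Set) : Set where
  var  : ℕ → Form I
  neg  : Form I → Form I
  or   : Form I → Form I → Form I
  boxAk : (k : ℕ) → I k → Form I → Form I
  box₁ : Form I → Form I
  box₂ : Form I → Form I

size : ∀ {I} → Form I → ℕ
size (var x)      = 1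
size (neg φ)      = suc (size φ)
size (or φ ψ)     = suc (size φ + size ψ)
size (boxAk k _ φ) = suc (size φ)
size (box₁ φ)     = suc (size φ)
size (box₂ φ)     = suc (size φ)

sat : ∀ {I n} → Model n → Form I → Fin n → Bool
sat M (var x)       = Π M x
sat M (neg φ) w     = not (sat M φ w)
sat M (or φ ψ) w    = sat M φ w ∨ sat M ψ w
sat M (boxAk k _ φ) = boxA M k (sat M φ)
sat M (box₁ φ)      = box M one (sat M φ)
sat M (box₂ φ)      = box M two (sat M φ)

p : ℕ
p = 0

{-# OPTIONS --safe #-}
module Submission where

-- Evaluate formulas at the root of the full binary tree of depth N = 2mℓ whose
-- nodes, the words over {1,2}, carry a truth value for p.  Such trees are
-- finite models, so ψ and [A_ℓ]^{2m} p agree on them.  For every choice vector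
-- b ∈ {1,2}^m we build two labellings A b and B b that differ only at one word
-- target b, which is a path of [A_ℓ]^{2m}; hence ψ is true under A b and false
-- under B b.  Say a formula separates b at a node if its value there differs
-- between A b and B b.  By induction on φ, at most |φ| vectors are separated by
-- φ at any node: Boolean connectives and the boxes □₁, □₂ pass separation on to
-- their arguments, and a box [A_k] with k ∈ I passes all of it on through one of
-- its two branches, because [A_k] separates nothing at a node where target b and
-- target b′ part.  This is what the labellings are built for: target b is made of
-- pairs of alternating blocks of length ℓ that repeat the letter where they meet,
-- so a branch of [A_k] along it has k < ℓ, and A and B disregard the first ℓ-1
-- letters after each pair boundary, which makes the two branches look alike.

open import Defs
open import Data.Nat using (ℕ; zero; suc; _+_; _*_; _^_; _∸_; _≤_; _<_; _<ᵇ_; z≤n; s≤s)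
open import Data.Nat.Properties
  using (≤-refl; ≤-trans; ≤-reflexive; ≤-pred; m≤n⇒m≤1+n; m≤n+m; +-mono-≤; +-comm; +-suc;
         +-identityʳ; *-suc; _≤?_; ≰⇒>; ≤∧≢⇒<; 1+n≢0; m∸n≢0⇒n<m; ∸-+-assoc; m+n≤o⇒m≤o;
         m+n≤o⇒m≤o∸n; m≤n⇒∃[o]m+o≡n; +-commutativeSemigroup; module ≤-Reasoning)
open import Algebra.Properties.CommutativeSemigroup +-commutativeSemigroup using (interchange)
open import Data.Bool using (Bool; true; false; not; _∧_; _∨_; if_then_else_)
open import Data.Bool.Properties
  using (∧-comm; ∧-zeroʳ; ∧-identityʳ; ∧-inverseʳ; ∧-conicalˡ; ∧-conicalʳ; ∨-zeroʳ; ∨-identityʳ;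
         ¬-not; not-¬)
open import Data.Fin using (Fin)
open import Data.List using (List; []; _∷_; _++_; _∷ʳ_; length; map; drop; lookup; allFin)
open import Data.List.Properties
  using (≡-dec; ++-assoc; ++-identityʳ; ++-cancelˡ; ++-conicalˡ; ++-conicalʳ; length-++;
         ∷-injectiveˡ; ∷-injectiveʳ)
open import Data.List.Membership.Propositional using (_∈_)
open import Data.List.Membership.Propositional.Properties using (∈-map⁺; ∈-++⁺ˡ; ∈-++⁺ʳ; ∈-allFin)
open import Data.List.Relation.Unary.Any using (here; there; index)
open import Data.List.Relation.Unary.Any.Properties using (lookup-index)
open import Data.Vec using (Vec; []; _∷_)
import Data.Vec.Properties as Vec
open import Data.Product using (_×_; _,_; ∃-syntax; proj₁; proj₂)
open import Data.Sum using (_⊎_; inj₁; inj₂; [_,_])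
open import Data.Empty using (⊥; ⊥-elim)
open import Function using (_∘_; id)
open import Relation.Binary.Definitions using (DecidableEquality; Decidable)
open import Relation.Binary.PropositionalEquality
  using (_≡_; _≢_; refl; sym; trans; cong; cong₂; subst; subst₂; _≗_; module ≡-Reasoning)
open import Relation.Nullary using (¬_; yes; no; does)
open import Relation.Nullary.Decidable using (dec-true; dec-false)

infix 4.4 _≻_
_≻_ : Bool → Bool → Bool
x ≻ y = x ∧ not y

≻-false : ∀ {x y} → (x ≡ true → y ≡ true) → x ≻ y ≡ false
≻-false {false} _   = refl
≻-false {true}  x⇒y rewrite x⇒y refl = refl

≻-∨ : ∀ x₁ x₂ y₁ y₂ → x₁ ∨ x₂ ≻ y₁ ∨ y₂ ≡ true → x₁ ≻ y₁ ≡ true ⊎ x₂ ≻ y₂ ≡ true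
≻-∨ true  _     false false _ = inj₁ refl
≻-∨ false true  false false _ = inj₂ refl
≻-∨ true  _     true  _     ()
≻-∨ true  _     false true  ()
≻-∨ false true  true  _     ()
≻-∨ false true  false true  ()
≻-∨ false false _     _     ()

≻-∧ : ∀ x₁ x₂ y₁ y₂ → x₁ ∧ x₂ ≻ y₁ ∧ y₂ ≡ true → x₁ ≻ y₁ ≡ true ⊎ x₂ ≻ y₂ ≡ true
≻-∧ true  true  false _     _ = inj₁ refl
≻-∧ true  true  true  false _ = inj₂ refl
≻-∧ true  true  true  true  ()
≻-∧ true  false _     _     ()
≻-∧ false _     _     _     ()

not-≻ : ∀ x y → not x ≻ not y ≡ y ≻ x
not-≻ true  true  = refl
not-≻ true  false = refl
not-≻ false true  = refl
not-≻ false false = refl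

≻-≻-true : ∀ x y → x ≻ (x ≻ y) ≡ true → y ≡ true
≻-≻-true true true _ = refl

≻-≻-false : ∀ x y → (x ≻ y) ≻ x ≡ false
≻-≻-false true  true  = refl
≻-≻-false true  false = refl
≻-≻-false false _     = refl

∧-≻-idem : ∀ x z → x ∧ z ≻ z ∧ z ≡ false
∧-≻-idem true  true  = refl
∧-≻-idem true  false = refl
∧-≻-idem false _     = refl

∨-≻-absorb : ∀ {x y} → (y ≡ true → x ≡ false) → x ∨ y ≻ y ≡ x
∨-≻-absorb {x}     {false} _ = trans (∧-identityʳ _) (∨-identityʳ x)
∨-≻-absorb {false} {true}  _ = refl
∨-≻-absorb {true}  {true}  y⇒¬x with y⇒¬x refl
... | ()

not-≻-≻ : ∀ {x y} → (y ≡ true → x ≡ true) → not (x ≻ y) ≻ y ≡ not (x ≻ false)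
not-≻-≻ {x}     {false} _ = ∧-identityʳ _
not-≻-≻ {true}  {true}  _ = refl
not-≻-≻ {false} {true}  y⇒x with y⇒x refl
... | ()

module _ {A : Set} where

  infix 4 _≼_
  _≼_ : List A → List A → Set
  u ≼ v = ∃[ t ] u ++ t ≡ v

  ≼-head : ∀ {x y u v} → x ∷ u ≼ y ∷ v → x ≡ y
  ≼-head (_ , eq) = ∷-injectiveˡ eq

  ≼-tail : ∀ {x y u v} → x ∷ u ≼ y ∷ v → u ≼ v
  ≼-tail (t , eq) = t , ∷-injectiveʳ eq

  ≼-cancelˡ : ∀ u {v w} → u ++ v ≼ u ++ w → v ≼ w
  ≼-cancelˡ []      v≼w = v≼w
  ≼-cancelˡ (x ∷ u) p   = ≼-cancelˡ u (≼-tail p)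

  ∷⋠[] : ∀ w {x s} → ¬ (w ++ x ∷ s ≼ [])
  ∷⋠[] w {x} {s} (t , eq) with ++-conicalʳ w (x ∷ s) (++-conicalˡ (w ++ x ∷ s) t eq)
  ... | ()

  ≼-dec : DecidableEquality A → Decidable _≼_
  ≼-dec _≟_ []      v       = yes (v , refl)
  ≼-dec _≟_ (x ∷ u) []      = no λ ()
  ≼-dec _≟_ (x ∷ u) (y ∷ v) with x ≟ y | ≼-dec _≟_ u v
  ... | yes refl | yes (t , eq) = yes (t , cong (x ∷_) eq)
  ... | yes refl | no u⋠v       = no (u⋠v ∘ ≼-tail)
  ... | no x≢y   | _            = no (x≢y ∘ ≼-head)

  ≼-align : ∀ u w {y y′ x x′ s s′} → x ≢ x′ → w ++ x ∷ s ≼ u ++ y → w ++ x′ ∷ s′ ≼ u ++ y′ →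
            ∃[ w′ ] w ≡ u ++ w′ × w′ ++ x ∷ s ≼ y × w′ ++ x′ ∷ s′ ≼ y′
  ≼-align []      w       _    p p′ = w , refl , p , p′
  ≼-align (z ∷ u) []      x≢x′ p p′ = ⊥-elim (x≢x′ (trans (≼-head p) (sym (≼-head p′))))
  ≼-align (z ∷ u) (v ∷ w) x≢x′ p p′ with ≼-align u w x≢x′ (≼-tail p) (≼-tail p′)
  ... | w′ , refl , q , q′ = w′ , cong (_∷ u ++ w′) (≼-head p) , q , q′

  module WithPrefix (_≟_ : DecidableEquality A) where

    withPrefix : List A → (List A → Bool) → List A → Bool
    withPrefix []      k v       = k v
    withPrefix (x ∷ u) k []      = false
    withPrefix (x ∷ u) k (y ∷ v) = does (x ≟ y) ∧ withPrefix u k v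

    withPrefix-++ : ∀ u k r → withPrefix u k (u ++ r) ≡ k r
    withPrefix-++ []      k r = refl
    withPrefix-++ (x ∷ u) k r rewrite dec-true (x ≟ x) refl = withPrefix-++ u k r

    withPrefix-sound : ∀ u k v → withPrefix u k v ≡ true → ∃[ r ] v ≡ u ++ r × k r ≡ true
    withPrefix-sound []      k v       kv = v , refl , kv
    withPrefix-sound (x ∷ u) k (y ∷ v) eq with x ≟ y
    ... | yes refl with withPrefix-sound u k v eq
    ...   | r , refl , kr = r , refl , kr

allB-true : ∀ {A : Set} (f : A → Bool) xs → (∀ x → f x ≡ true) → allB f xs ≡ true
allB-true f []       f-true = refl
allB-true f (x ∷ xs) f-true rewrite f-true x = allB-true f xs f-true

allB-false : ∀ {A : Set} (f : A → Bool) {x xs} → x ∈ xs → f x ≡ false → allB f xs ≡ false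
allB-false f (here refl) fx≡false rewrite fx≡false = refl
allB-false f {xs = y ∷ _} (there x∈) fx≡false with f y
... | true  = allB-false f x∈ fx≡false
... | false = refl

allB-guarded : ∀ {A : Set} (R g : A → Bool) {c x₀} xs → x₀ ∈ xs → R x₀ ≡ true →
               (∀ x → R x ≡ true → g x ≡ c) → allB (λ x → not (R x) ∨ g x) xs ≡ c
allB-guarded R g {true} xs _ _ R⇒g = allB-true _ xs guarded
  where
    guarded : ∀ x → not (R x) ∨ g x ≡ true
    guarded x with R x in Rx
    ... | true  = R⇒g x Rx
    ... | false = refl
allB-guarded R g {false} xs x₀∈ Rx₀ R⇒g =
  allB-false _ x₀∈ (trans (cong (λ r → not r ∨ g _) Rx₀) (R⇒g _ Rx₀))

-- Words and alternating words

Word : Set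
Word = List Letter

_≟ᴸ_ : DecidableEquality Letter
one ≟ᴸ one = yes refl
one ≟ᴸ two = no λ ()
two ≟ᴸ one = no λ ()
two ≟ᴸ two = yes refl

_≟ʷ_ : DecidableEquality Word
_≟ʷ_ = ≡-dec _≟ᴸ_

infix 4.5 _==_
_==_ : Word → Word → Bool
u == v = does (u ≟ʷ v)

==-refl : ∀ u → u == u ≡ true
==-refl u = dec-true (u ≟ʷ u) refl

==-false : ∀ {u v} → u ≢ v → u == v ≡ false
==-false {u} {v} = dec-false (u ≟ʷ v)

==-sound : ∀ {u v} → u == v ≡ true → u ≡ v
==-sound {u} {v} eq with u ≟ʷ v
... | yes u≡v = u≡v

==-++ : ∀ u {v w} → u ++ v == u ++ w ≡ v == w
==-++ u {v} {w} with v ≟ʷ w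
... | yes refl = ==-refl (u ++ v)
... | no v≢w   = ==-false (v≢w ∘ ++-cancelˡ u v w)

other-≢ : ∀ a → other a ≢ a
other-≢ one ()
other-≢ two ()

other-injective : ∀ {a b} → other a ≡ other b → a ≡ b
other-injective {one} {one} _ = refl
other-injective {two} {two} _ = refl

altAt : Letter → ℕ → Letter
altAt a zero    = a
altAt a (suc n) = altAt (other a) n

altAt-suc : ∀ a n → altAt a (suc n) ≡ other (altAt a n)
altAt-suc a zero    = refl
altAt-suc a (suc n) = altAt-suc (other a) n

altAt-injective : ∀ {a b} n → altAt a n ≡ altAt b n → a ≡ b
altAt-injective zero    eq = eq
altAt-injective (suc n) eq = other-injective (altAt-injective n eq)

length-alt : ∀ a k → length (alt a k) ≡ k
length-alt a zero    = refl
length-alt a (suc k) = cong suc (length-alt (other a) k)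

alt-+ : ∀ a n j → alt a (n + j) ≡ alt a n ++ alt (altAt a n) j
alt-+ a zero    j = refl
alt-+ a (suc n) j = cong (a ∷_) (alt-+ (other a) n j)

drop-alt-++ : ∀ a {k n} t → k ≤ n → drop n (alt a k ++ t) ≡ drop (n ∸ k) t
drop-alt-++ a t z≤n       = refl
drop-alt-++ a t (s≤s k≤n) = drop-alt-++ (other a) t k≤n

drop-alt-suc-++ : ∀ a n t → drop n (alt a (suc n) ++ t) ≡ altAt a n ∷ t
drop-alt-suc-++ a zero    t = refl
drop-alt-suc-++ a (suc n) t = drop-alt-suc-++ (other a) n t

-- Semantics on full binary trees

Valuation : Set
Valuation = Word → Bool

infixl 9 _at_
_at_ : Valuation → Word → Valuation
(V at u) t = V (u ++ t)

at-++ : ∀ V u v → V at u at v ≗ V at (u ++ v)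
at-++ V u v t = cong V (sym (++-assoc u v t))

-- F V d is the value of F at the root of the full binary tree of depth d whose node u is labelled V u.
TreeProp : Set
TreeProp = Valuation → ℕ → Bool

Congruent : TreeProp → Set
Congruent F = ∀ {V V′} → V ≗ V′ → ∀ d → F V d ≡ F V′ d

rootLabel : TreeProp
rootLabel V d = V []

□ : Letter → TreeProp → TreeProp
□ a F V zero    = true
□ a F V (suc d) = F (V at (a ∷ [])) d

□* : Word → TreeProp → TreeProp
□* []      F = F
□* (a ∷ s) F = □ a (□* s F)

□A : ℕ → TreeProp → TreeProp
□A k F V d = □* (alt one k) F V d ∧ □* (alt two k) F V d

□A-iter : ℕ → ℕ → TreeProp → TreeProp
□A-iter ℓ zero    F = F
□A-iter ℓ (suc i) F = □A ℓ (□A-iter ℓ i F)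

⟦_⟧ : ∀ {I} → Form I → TreeProp
⟦ var zero ⟧    = rootLabel
⟦ var (suc _) ⟧ = λ V d → false
⟦ neg φ ⟧       = λ V d → not (⟦ φ ⟧ V d)
⟦ or φ χ ⟧      = λ V d → ⟦ φ ⟧ V d ∨ ⟦ χ ⟧ V d
⟦ boxAk k _ φ ⟧ = □A k ⟦ φ ⟧
⟦ box₁ φ ⟧      = □ one ⟦ φ ⟧
⟦ box₂ φ ⟧      = □ two ⟦ φ ⟧

rootLabel-cong : Congruent rootLabel
rootLabel-cong V≗V′ d = V≗V′ []

□-cong : ∀ {F} a → Congruent F → Congruent (□ a F)
□-cong a F-cong V≗V′ zero    = refl
□-cong a F-cong V≗V′ (suc d) = F-cong (V≗V′ ∘ (a ∷_)) d

□*-cong : ∀ {F} s → Congruent F → Congruent (□* s F)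
□*-cong []      F-cong = F-cong
□*-cong (a ∷ s) F-cong = □-cong a (□*-cong s F-cong)

□A-cong : ∀ {F} k → Congruent F → Congruent (□A k F)
□A-cong k F-cong V≗V′ d =
  cong₂ _∧_ (□*-cong (alt one k) F-cong V≗V′ d) (□*-cong (alt two k) F-cong V≗V′ d)

□A-iter-cong : ∀ {F} ℓ i → Congruent F → Congruent (□A-iter ℓ i F)
□A-iter-cong ℓ zero    F-cong = F-cong
□A-iter-cong ℓ (suc i) F-cong = □A-cong ℓ (□A-iter-cong ℓ i F-cong)

⟦⟧-cong : ∀ {I} (φ : Form I) → Congruent ⟦ φ ⟧
⟦⟧-cong (var zero)    = rootLabel-cong
⟦⟧-cong (var (suc _)) V≗V′ d = refl
⟦⟧-cong (neg φ)       V≗V′ d = cong not (⟦⟧-cong φ V≗V′ d)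
⟦⟧-cong (or φ χ)      V≗V′ d = cong₂ _∨_ (⟦⟧-cong φ V≗V′ d) (⟦⟧-cong χ V≗V′ d)
⟦⟧-cong (boxAk k _ φ) = □A-cong k (⟦⟧-cong φ)
⟦⟧-cong (box₁ φ)      = □-cong one (⟦⟧-cong φ)
⟦⟧-cong (box₂ φ)      = □-cong two (⟦⟧-cong φ)

□*-unfold : ∀ s F V {n d} → length s ≡ n → n ≤ d → □* s F V d ≡ F (V at s) (d ∸ n)
□*-unfold []      F V refl _         = refl
□*-unfold (a ∷ s) F V refl (s≤s n≤d) = □*-unfold s F (V at (a ∷ [])) refl n≤d

□*-vacuous : ∀ s F V {n d} → length s ≡ n → d < n → □* s F V d ≡ true
□*-vacuous (a ∷ s) F V {d = zero}  refl _         = refl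
□*-vacuous (a ∷ s) F V {d = suc d} refl (s≤s d<n) = □*-vacuous s F (V at (a ∷ [])) refl d<n

□*-true : ∀ s F V d → (∀ d′ → F (V at s) d′ ≡ true) → □* s F V d ≡ true
□*-true []      F V d       F-true = F-true d
□*-true (a ∷ s) F V zero    F-true = refl
□*-true (a ∷ s) F V (suc d) F-true = □*-true s F (V at (a ∷ [])) d F-true

□*-alt-unfold : ∀ c {k} F V {d} → k ≤ d → □* (alt c k) F V d ≡ F (V at alt c k) (d ∸ k)
□*-alt-unfold c {k} F V = □*-unfold (alt c k) F V (length-alt c k)

□A-unfold : ∀ c {k} F V {d} → k ≤ d →
            □A k F V d ≡ F (V at alt c k) (d ∸ k) ∧ F (V at alt (other c) k) (d ∸ k)
□A-unfold one F V k≤d = cong₂ _∧_ (□*-alt-unfold one F V k≤d) (□*-alt-unfold two F V k≤d)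
□A-unfold two {k} F V {d} k≤d =
  trans (∧-comm (□* (alt one k) F V d) _)
        (cong₂ _∧_ (□*-alt-unfold two F V k≤d) (□*-alt-unfold one F V k≤d))

□A-vacuous : ∀ {k} F V {d} → d < k → □A k F V d ≡ true
□A-vacuous {k} F V d<k
  rewrite □*-vacuous (alt one k) F V (length-alt one k) d<k
        | □*-vacuous (alt two k) F V (length-alt two k) d<k = refl

data Blocks (ℓ : ℕ) : ℕ → Word → Set where
  []  : Blocks ℓ 0 []
  _∷_ : ∀ {i s} c → Blocks ℓ i s → Blocks ℓ (suc i) (alt c ℓ ++ s)

□A-iter-true : ∀ ℓ i V d → (∀ s → Blocks ℓ i s → V s ≡ true) → □A-iter ℓ i rootLabel V d ≡ true
□A-iter-true ℓ zero    V d V-true = V-true [] []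
□A-iter-true ℓ (suc i) V d V-true = cong₂ _∧_ (branch one) (branch two)
  where
    branch : ∀ c → □* (alt c ℓ) (□A-iter ℓ i rootLabel) V d ≡ true
    branch c = □*-true (alt c ℓ) _ V d λ d′ →
      □A-iter-true ℓ i (V at alt c ℓ) d′ (λ s bs → V-true (alt c ℓ ++ s) (c ∷ bs))

□A-iter-false : ∀ {ℓ i s} V {d} → Blocks ℓ i s → V s ≡ false → i * ℓ ≤ d →
                □A-iter ℓ i rootLabel V d ≡ false
□A-iter-false V [] Vs≡false _ = Vs≡false
□A-iter-false {ℓ} {suc i} V {d} (c ∷ bs) Vs≡false iℓ≤d =
  trans (□A-unfold c F V (m+n≤o⇒m≤o ℓ iℓ≤d))
        (cong (_∧ F (V at alt (other c) ℓ) (d ∸ ℓ)) (□A-iter-false (V at alt c ℓ) bs Vs≡false iℓ≤d∸ℓ))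
  where
    F = □A-iter ℓ i rootLabel
    iℓ≤d∸ℓ : i * ℓ ≤ d ∸ ℓ
    iℓ≤d∸ℓ = m+n≤o⇒m≤o∸n (i * ℓ) (subst (_≤ d) (+-comm ℓ (i * ℓ)) iℓ≤d)

-- Finite tree models

wordsUpTo : ℕ → List Word
wordsUpTo zero    = [] ∷ []
wordsUpTo (suc N) = [] ∷ map (one ∷_) (wordsUpTo N) ++ map (two ∷_) (wordsUpTo N)

∈-wordsUpTo : ∀ {N} u → length u ≤ N → u ∈ wordsUpTo N
∈-wordsUpTo {zero}  []        _         = here refl
∈-wordsUpTo {suc N} []        _         = here refl
∈-wordsUpTo {suc N} (one ∷ u) (s≤s u≤N) = there (∈-++⁺ˡ (∈-map⁺ (one ∷_) (∈-wordsUpTo u u≤N)))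
∈-wordsUpTo {suc N} (two ∷ u) (s≤s u≤N) =
  there (∈-++⁺ʳ (map (one ∷_) (wordsUpTo N)) (∈-map⁺ (two ∷_) (∈-wordsUpTo u u≤N)))

module TreeModel (N : ℕ) (V : Valuation) where

  n : ℕ
  n = length (wordsUpTo N)

  node : Fin n → Word
  node = lookup (wordsUpTo N)

  node-surjective : ∀ u → length u ≤ N → ∃[ x ] node x ≡ u
  node-surjective u u≤N = index u∈ , sym (lookup-index u∈)
    where u∈ = ∈-wordsUpTo u u≤N

  depth : Fin n → ℕ
  depth x = N ∸ length (node x)

  -- Guarding edges by the depth spares us bounding the length of the enumerated words.
  edge : Letter → Fin n → Fin n → Bool
  edge a x y = (0 <ᵇ depth x) ∧ (node y == node x ∷ʳ a)

  M : Model n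
  M = record { R₁ = edge one ; R₂ = edge two ; Π = λ { zero x → V (node x) ; (suc _) _ → false } }

  rel-M : ∀ a x y → rel M a x y ≡ edge a x y
  rel-M one x y = refl
  rel-M two x y = refl

  Represents : TreeProp → (Fin n → Bool) → Set
  Represents F g = ∀ x → g x ≡ F (V at node x) (depth x)

  box-rep : ∀ {F g} a → Congruent F → Represents F g → Represents (□ a F) (box M a g)
  box-rep {F} {g} a F-cong g-rep x with depth x in depth-x
  ... | zero = allB-true _ (allFin n) λ y → cong (λ r → not r ∨ g y) (no-edge y)
    where
      no-edge : ∀ y → rel M a x y ≡ false
      no-edge y = trans (rel-M a x y) (cong (λ k → (0 <ᵇ k) ∧ (node y == node x ∷ʳ a)) depth-x)
  ... | suc d = allB-guarded (rel M a x) g (allFin n) (∈-allFin child) edge-child g-child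
    where
      u = node x ∷ʳ a
      edge-to : ∀ y → rel M a x y ≡ (node y == u)
      edge-to y = trans (rel-M a x y) (cong (λ k → (0 <ᵇ k) ∧ (node y == u)) depth-x)
      u≤N : length u ≤ N
      u≤N = subst (_≤ N) (sym (trans (length-++ (node x)) (+-comm (length (node x)) 1)))
                  (m∸n≢0⇒n<m (1+n≢0 ∘ trans (sym depth-x)))
      depth-u : N ∸ length u ≡ d
      depth-u = trans (cong (N ∸_) (length-++ (node x)))
                      (trans (sym (∸-+-assoc N (length (node x)) 1)) (cong (_∸ 1) depth-x))
      child = proj₁ (node-surjective u u≤N)
      edge-child : rel M a x child ≡ true
      edge-child = trans (edge-to child) (dec-true (node child ≟ʷ u) (proj₂ (node-surjective u u≤N)))
      g-child : ∀ y → rel M a x y ≡ true → g y ≡ F (V at node x at (a ∷ [])) d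
      g-child y e = begin
        g y                          ≡⟨ g-rep y ⟩
        F (V at node y) (depth y)    ≡⟨ cong (λ v → F (V at v) (N ∸ length v)) node-y ⟩
        F (V at u) (N ∸ length u)    ≡⟨ cong (F (V at u)) depth-u ⟩
        F (V at u) d                 ≡⟨ F-cong (sym ∘ at-++ V (node x) (a ∷ [])) d ⟩
        F (V at node x at (a ∷ [])) d ∎
        where
          open ≡-Reasoning
          node-y : node y ≡ u
          node-y = ==-sound (trans (sym (edge-to y)) e)

  boxWord-rep : ∀ {F g} s → Congruent F → Represents F g → Represents (□* s F) (boxWord M s g)
  boxWord-rep []      F-cong g-rep = g-rep
  boxWord-rep (a ∷ s) F-cong g-rep = box-rep a (□*-cong s F-cong) (boxWord-rep s F-cong g-rep)

  boxA-rep : ∀ {F g} k → Congruent F → Represents F g → Represents (□A k F) (boxA M k g)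
  boxA-rep k F-cong g-rep x =
    cong₂ _∧_ (boxWord-rep (alt one k) F-cong g-rep x) (boxWord-rep (alt two k) F-cong g-rep x)

  p-rep : Represents rootLabel (Π M p)
  p-rep x = cong V (sym (++-identityʳ (node x)))

  sat-rep : ∀ {I} (φ : Form I) → Represents ⟦ φ ⟧ (sat M φ)
  sat-rep (var zero)      = p-rep
  sat-rep (var (suc _)) x = refl
  sat-rep (neg φ)       x = cong not (sat-rep φ x)
  sat-rep (or φ χ)      x = cong₂ _∨_ (sat-rep φ x) (sat-rep χ x)
  sat-rep (boxAk k _ φ)   = boxA-rep k (⟦⟧-cong φ) (sat-rep φ)
  sat-rep (box₁ φ)        = box-rep one (⟦⟧-cong φ) (sat-rep φ)
  sat-rep (box₂ φ)        = box-rep two (⟦⟧-cong φ) (sat-rep φ)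

  iterA-rep : ∀ ℓ i → Represents (□A-iter ℓ i rootLabel) (iterA M ℓ i (Π M p))
  iterA-rep ℓ zero    = p-rep
  iterA-rep ℓ (suc i) = boxA-rep ℓ (□A-iter-cong ℓ i rootLabel-cong) (iterA-rep ℓ i)

tree-equivalence : ∀ {I} (ψ : Form I) ℓ i →
                   (∀ n (M : Model n) w → sat M ψ w ≡ iterA M ℓ i (Π M p) w) →
                   ∀ V N → ⟦ ψ ⟧ V N ≡ □A-iter ℓ i rootLabel V N
tree-equivalence ψ ℓ i ψ≡ V N =
  subst (λ u → ⟦ ψ ⟧ (V at u) (N ∸ length u) ≡ □A-iter ℓ i rootLabel (V at u) (N ∸ length u))
        (proj₂ (node-surjective [] z≤n))
        (trans (sym (sat-rep ψ root)) (trans (ψ≡ n M root) (iterA-rep ℓ i root)))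
  where
    open TreeModel N V
    root = proj₁ (node-surjective [] z≤n)

-- The labellings A b and B b

data Polarity : Set where
  pos neg : Polarity

opposite : Polarity → Polarity
opposite pos = neg
opposite neg = pos

-- [A_k] cannot separate b with polarity pol where target b leaves along alt (lead pol) k.
lead : Polarity → Letter
lead pos = one
lead neg = two

module Construction (h : ℕ) where

  open WithPrefix _≟ᴸ_

  ℓ : ℕ
  ℓ = suc h

  blockEnd : Letter → Letter
  blockEnd c = altAt c h

  pair : Letter → Word
  pair c = alt c ℓ ++ alt (blockEnd c) ℓ

  pair-++ : ∀ c x → pair c ++ x ≡ alt c ℓ ++ alt (blockEnd c) ℓ ++ x
  pair-++ c = ++-assoc (alt c ℓ) (alt (blockEnd c) ℓ)

  pairSuffix : Letter → Word
  pairSuffix c = blockEnd c ∷ alt (blockEnd c) ℓ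

  drop-block : ∀ a r → drop h (alt a ℓ ++ r) ≡ blockEnd a ∷ r
  drop-block a = drop-alt-suc-++ a h

  drop-pair : ∀ c x → drop h (pair c ++ x) ≡ pairSuffix c ++ x
  drop-pair c x = trans (cong (drop h) (pair-++ c x)) (drop-block c (alt (blockEnd c) ℓ ++ x))

  target : ∀ {m} → Vec Letter m → Word
  target []      = []
  target (c ∷ b) = pair c ++ target b

  target-blocks : ∀ {m} (b : Vec Letter m) → Blocks ℓ (2 * m) (target b)
  target-blocks []              = []
  target-blocks {suc m} (c ∷ b) =
    subst₂ (Blocks ℓ) (sym (*-suc 2 m)) (sym (pair-++ c (target b))) (c ∷ blockEnd c ∷ target-blocks b)

  target-injective : ∀ {m} {b b′ : Vec Letter m} → target b ≡ target b′ → b ≡ b′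
  target-injective {b = []}    {[]}      _  = refl
  target-injective {b = c ∷ b} {c′ ∷ b′} eq with ∷-injectiveˡ eq
  ... | refl = cong (c ∷_) (target-injective (++-cancelˡ (pair c) (target b) (target b′) eq))

  -- Z b x ignores the first h letters of x, so A b labels the branches alt 1 k and alt 2 k
  -- (k ≤ h) alike (root-twins).  B (one ∷ b) is false at target (one ∷ b); the disjunct
  -- r == target b makes A (one ∷ b) false at its twin on the alt 2 k branch, while the
  -- exception x == target (one ∷ b) keeps A true at the target itself.
  Z : ∀ {m} → Vec Letter m → Word → Bool
  Z []        x = false
  Z (one ∷ b) x = withPrefix (pairSuffix one) (λ r → Z b r ∨ (r == target b)) (drop h x)
                  ≻ x == target (one ∷ b)
  Z (two ∷ b) x = withPrefix (pairSuffix two) (Z b) (drop h x)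

  A B : ∀ {m} → Vec Letter m → Valuation
  A b x = not (Z b x)
  B b x = A b x ≻ x == target b

  pairSuffix-sound : ∀ c {a a′ k s} → withPrefix (pairSuffix c) k (blockEnd a ∷ alt a′ ℓ ++ s) ≡ true →
                     a ≡ c × a′ ≡ blockEnd c × k s ≡ true
  pairSuffix-sound c {a} {a′} {k} {s} eq with withPrefix-sound (pairSuffix c) k _ eq
  ... | r , e , kr with ∷-injectiveˡ (∷-injectiveʳ e)
  ...   | refl = altAt-injective h (∷-injectiveˡ e) , refl
               , subst (λ t → k t ≡ true) (sym (++-cancelˡ (alt a′ ℓ) s r (∷-injectiveʳ e))) kr

  Z-∷-blocks : ∀ {m} c (b : Vec Letter m) a a′ s → Z b s ≡ false →
               Z (c ∷ b) (alt a ℓ ++ alt a′ ℓ ++ s) ≡ false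
  Z-∷-blocks one b a a′ s Zs rewrite drop-block a (alt a′ ℓ ++ s) = ≻-false hits-target
    where
      κ = λ r → Z b r ∨ (r == target b)
      hits-target : withPrefix (pairSuffix one) κ (blockEnd a ∷ alt a′ ℓ ++ s) ≡ true →
                    alt a ℓ ++ alt a′ ℓ ++ s == target (one ∷ b) ≡ true
      hits-target eq with pairSuffix-sound one eq
      ... | refl , refl , s-ok rewrite Zs =
        dec-true (_ ≟ʷ _) (trans (sym (pair-++ one s)) (cong (pair one ++_) (==-sound s-ok)))
  Z-∷-blocks two b a a′ s Zs rewrite drop-block a (alt a′ ℓ ++ s) =
    ¬-not λ eq → not-¬ (proj₂ (proj₂ (pairSuffix-sound two eq))) Zs

  Z-blocks : ∀ {m s} (b : Vec Letter m) → Blocks ℓ (2 * m) s → Z b s ≡ false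
  Z-blocks []                  _  = refl
  Z-blocks {suc m} {s} (c ∷ b) bs with subst (λ i → Blocks ℓ i s) (*-suc 2 m) bs
  ... | a ∷ a′ ∷ bs′ = Z-∷-blocks c b a a′ _ (Z-blocks b bs′)

  A-peel : ∀ {m} c (b : Vec Letter m) x → A (c ∷ b) (pair c ++ x) ≡ A b x
  A-peel one b x
    rewrite drop-pair one x | withPrefix-++ (pairSuffix one) (λ r → Z b r ∨ (r == target b)) x
          | ==-++ (pair one) {x} {target b}
    = cong not (∨-≻-absorb λ e → trans (cong (Z b) (==-sound e)) (Z-blocks b (target-blocks b)))
  A-peel two b x rewrite drop-pair two x | withPrefix-++ (pairSuffix two) (Z b) x = refl

  B-peel : ∀ {m} c (b : Vec Letter m) x → B (c ∷ b) (pair c ++ x) ≡ B b x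
  B-peel c b x = cong₂ _≻_ (A-peel c b x) (==-++ (pair c))

  B-off-target : ∀ {m} (b : Vec Letter m) {x} → x ≢ target b → B b x ≡ A b x
  B-off-target b {x} x≢t = trans (cong (A b x ≻_) (==-false x≢t)) (∧-identityʳ (A b x))

  B-target : ∀ {m} (b : Vec Letter m) → B b (target b) ≡ false
  B-target b = trans (cong (A b (target b) ≻_) (==-refl (target b))) (∧-zeroʳ (A b (target b)))

  B-alt-one≡A-alt-two : ∀ {m} (b : Vec Letter m) {k} t → suc k ≤ h →
                        B (one ∷ b) (alt one (suc k) ++ t) ≡ A (one ∷ b) (alt two (suc k) ++ t)
  B-alt-one≡A-alt-two b {k} t K≤h = begin
      B (one ∷ b) x₁
        ≡⟨ not-≻-≻ target⇒Q ⟩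
      not (Q (drop h x₁) ≻ false)
        ≡⟨ cong₂ (λ v e → not (Q v ≻ e)) same-drop (sym (==-false {x₂} {target (one ∷ b)} λ ())) ⟩
      A (one ∷ b) x₂ ∎
    where
      open ≡-Reasoning
      Q = withPrefix (pairSuffix one) (λ r → Z b r ∨ (r == target b))
      x₁ = alt one (suc k) ++ t
      x₂ = alt two (suc k) ++ t
      same-drop : drop h x₁ ≡ drop h x₂
      same-drop = trans (drop-alt-++ one t K≤h) (sym (drop-alt-++ two t K≤h))
      target⇒Q : x₁ == target (one ∷ b) ≡ true → Q (drop h x₁) ≡ true
      target⇒Q e = subst (λ v → Q (drop h v) ≡ true) (sym (==-sound e)) (begin
        Q (drop h (pair one ++ target b))       ≡⟨ cong Q (drop-pair one (target b)) ⟩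
        Q (pairSuffix one ++ target b)          ≡⟨ withPrefix-++ (pairSuffix one) _ (target b) ⟩
        Z b (target b) ∨ (target b == target b) ≡⟨ cong (Z b (target b) ∨_) (==-refl (target b)) ⟩
        Z b (target b) ∨ true                   ≡⟨ ∨-zeroʳ _ ⟩
        true                                    ∎)

  val : ∀ {m} → Polarity → Vec Letter m → Valuation
  val pos = A
  val neg = B

  val-peel : ∀ {m} pol c (b : Vec Letter m) x → val pol (c ∷ b) (pair c ++ x) ≡ val pol b x
  val-peel pos = A-peel
  val-peel neg = B-peel

  root-twins : ∀ {m} pol (b : Vec Letter m) {k} → suc k ≤ h →
               let c = lead pol ; K = suc k ; V = val pol (c ∷ b) ; V′ = val (opposite pol) (c ∷ b) in
               (V′ at alt c K ≗ V at alt (other c) K) × (V′ at alt (other c) K ≗ V at alt (other c) K)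
  root-twins pos b K≤h = (λ t → B-alt-one≡A-alt-two b t K≤h) , (λ t → B-off-target (one ∷ b) λ ())
  root-twins neg b {k} K≤h = (λ t → trans (A-drop t) (sym (B-off-target (two ∷ b) λ ())))
                           , (λ t → sym (B-off-target (two ∷ b) λ ()))
    where
      A-drop : ∀ t → A (two ∷ b) (alt two (suc k) ++ t) ≡ A (two ∷ b) (alt one (suc k) ++ t)
      A-drop t = cong (λ v → not (withPrefix (pairSuffix two) (Z b) v))
                      (trans (drop-alt-++ two t K≤h) (sym (drop-alt-++ one t K≤h)))

  alt-≼-pair⇒≤ℓ : ∀ c {k} X → alt c k ≼ pair c ++ X → k ≤ ℓ
  alt-≼-pair⇒≤ℓ c {k} X p with k ≤? ℓ
  ... | yes k≤ℓ = k≤ℓ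
  ... | no  k≰ℓ with m≤n⇒∃[o]m+o≡n (≰⇒> k≰ℓ)
  ...   | j , refl = ⊥-elim (other-≢ (blockEnd c) (trans (sym (altAt-suc c h)) repeat))
    where
      p′ : alt c ℓ ++ alt (altAt c ℓ) (suc j) ≼ alt c ℓ ++ alt (blockEnd c) ℓ ++ X
      p′ = subst₂ _≼_ (trans (cong (alt c) (sym (+-suc ℓ j))) (alt-+ c ℓ (suc j))) (pair-++ c X) p
      repeat : altAt c ℓ ≡ blockEnd c
      repeat = ≼-head (≼-cancelˡ (alt c ℓ) p′)

  Separates : ∀ {m} → Polarity → TreeProp → Word → ℕ → Vec Letter m → Bool
  Separates pol F w d b = F (val pol b at w) d ≻ F (val (opposite pol) b at w) d

  Separates-not : ∀ {m} pol F w d (b : Vec Letter m) →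
                  Separates pol (λ V d → not (F V d)) w d b ≡ Separates (opposite pol) F w d b
  Separates-not pos F w d b = not-≻ (F (A b at w) d) (F (B b at w) d)
  Separates-not neg F w d b = not-≻ (F (B b at w) d) (F (A b at w) d)

  Separates-at : ∀ {m F} → Congruent F → ∀ pol w s d (b : Vec Letter m) →
                 F (val pol b at w at s) d ≻ F (val (opposite pol) b at w at s) d
                 ≡ Separates pol F (w ++ s) d b
  Separates-at F-cong pol w s d b =
    cong₂ _≻_ (F-cong (at-++ (val pol b) w s) d) (F-cong (at-++ (val (opposite pol) b) w s) d)

  Separates-peel : ∀ {m F} → Congruent F → ∀ pol c w d (b : Vec Letter m) →
                   Separates pol F (pair c ++ w) d (c ∷ b) ≡ Separates pol F w d b
  Separates-peel F-cong pol c w d b = cong₂ _≻_ (F-cong (peel pol) d) (F-cong (peel (opposite pol)) d)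
    where
      peel : ∀ pol → val pol (c ∷ b) at (pair c ++ w) ≗ val pol b at w
      peel pol t = trans (cong (val pol (c ∷ b)) (++-assoc (pair c) w t)) (val-peel pol c b (w ++ t))

  Separates⇒≼target : ∀ {m F} → Congruent F → ∀ pol w d (b : Vec Letter m) →
                      Separates pol F w d b ≡ true → w ≼ target b
  Separates⇒≼target {F = F} F-cong pol w d b sep with ≼-dec _≟ᴸ_ w (target b)
  ... | yes w≼t = w≼t
  ... | no  w⋠t = ⊥-elim (not-¬ sep (no-separation pol))
    where
      agree : B b at w ≗ A b at w
      agree t = B-off-target b (λ e → w⋠t (t , e))
      no-separation : ∀ pol → Separates pol F w d b ≡ false
      no-separation pos = trans (cong (F (A b at w) d ≻_) (F-cong agree d)) (∧-inverseʳ (F (A b at w) d))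
      no-separation neg = trans (cong (_≻ F (A b at w) d) (F-cong agree d)) (∧-inverseʳ (F (A b at w) d))

  □A-blind-at-root : ∀ {m F} → Congruent F → ∀ pol {k d} (b : Vec Letter m) → suc k ≤ h →
                     Separates pol (□A (suc k) F) [] d (lead pol ∷ b) ≡ false
  □A-blind-at-root {F = F} F-cong pol {k} {d} b K≤h with suc k ≤? d
  ... | no K≰d = cong₂ _≻_ (□A-vacuous F V (≰⇒> K≰d)) (□A-vacuous F V′ (≰⇒> K≰d))
    where
      V  = val pol (lead pol ∷ b)
      V′ = val (opposite pol) (lead pol ∷ b)
  ... | yes K≤d = begin
      Separates pol (□A K F) [] d (c ∷ b)
        ≡⟨ cong₂ _≻_ (□A-unfold c F V K≤d) (□A-unfold c F V′ K≤d) ⟩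
      x ∧ z ≻ F (V′ at alt c K) (d ∸ K) ∧ F (V′ at alt (other c) K) (d ∸ K)
        ≡⟨ cong₂ (λ u v → x ∧ z ≻ u ∧ v) (F-cong twin₁ (d ∸ K)) (F-cong twin₂ (d ∸ K)) ⟩
      x ∧ z ≻ z ∧ z
        ≡⟨ ∧-≻-idem x z ⟩
      false ∎
    where
      open ≡-Reasoning
      K  = suc k
      c  = lead pol
      V  = val pol (c ∷ b)
      V′ = val (opposite pol) (c ∷ b)
      x  = F (V at alt c K) (d ∸ K)
      z  = F (V at alt (other c) K) (d ∸ K)
      twin₁ = proj₁ (root-twins pol b K≤h)
      twin₂ = proj₂ (root-twins pol b K≤h)

  -- Peel the pairs common to w, target b and target b′ until w is empty.
  □A-blind-at-divergence : ∀ {F} → Congruent F → ∀ pol {k d m} (b b′ : Vec Letter m) w → suc k ≢ ℓ →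
                           w ++ alt (lead pol) (suc k) ≼ target b →
                           w ++ alt (other (lead pol)) (suc k) ≼ target b′ →
                           Separates pol (□A (suc k) F) w d b ≡ false
  □A-blind-at-divergence F-cong pol [] [] w _ p _ = ⊥-elim (∷⋠[] w p)
  □A-blind-at-divergence F-cong pol {d = d} (c ∷ b) (c′ ∷ b′) [] K≢ℓ p _ with ≼-head p
  ... | refl = □A-blind-at-root F-cong pol {d = d} b (≤-pred (≤∧≢⇒< (alt-≼-pair⇒≤ℓ c (target b) p) K≢ℓ))
  □A-blind-at-divergence {F} F-cong pol {k} {d} (c ∷ b) (c′ ∷ b′) (a ∷ w) K≢ℓ p p′
    with ≼-head p | ≼-head p′
  ... | refl | refl with ≼-align (pair a) (a ∷ w) (other-≢ (lead pol) ∘ sym) p p′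
  ...   | w₀ , refl , q , q′ =
    trans (Separates-peel {F = □A (suc k) F} (□A-cong (suc k) F-cong) pol a w₀ d b)
          (□A-blind-at-divergence F-cong pol {d = d} b b′ w₀ K≢ℓ q q′)

-- Counting choice vectors

count : ∀ m → (Vec Letter m → Bool) → ℕ
count zero    P = if P [] then 1 else 0
count (suc m) P = count m (P ∘ (one ∷_)) + count m (P ∘ (two ∷_))

count-all : ∀ m → count m (λ _ → true) ≡ 2 ^ m
count-all zero    = refl
count-all (suc m) = cong₂ _+_ (count-all m) (trans (count-all m) (sym (+-identityʳ (2 ^ m))))

count-none : ∀ m {P} → (∀ b → P b ≡ false) → count m P ≡ 0
count-none zero    none rewrite none [] = refl
count-none (suc m) none = cong₂ _+_ (count-none m (none ∘ (one ∷_))) (count-none m (none ∘ (two ∷_)))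

count-mono : ∀ m {P Q} → (∀ b → P b ≡ true → Q b ≡ true) → count m P ≤ count m Q
count-mono zero {P} P⇒Q with P [] in P[]
... | false = z≤n
... | true rewrite P⇒Q [] P[] = ≤-refl
count-mono (suc m) P⇒Q = +-mono-≤ (count-mono m (P⇒Q ∘ (one ∷_))) (count-mono m (P⇒Q ∘ (two ∷_)))

count-⊎ : ∀ m {P Q R} → (∀ b → P b ≡ true → Q b ≡ true ⊎ R b ≡ true) →
          count m P ≤ count m Q + count m R
count-⊎ zero {P} {Q} split with P [] in P[]
... | false = z≤n
... | true with split [] P[]
...   | inj₁ Q[] rewrite Q[] = s≤s z≤n
...   | inj₂ R[] rewrite R[] = m≤n+m 1 (count zero Q)
count-⊎ (suc m) {P} {Q} {R} split =
  ≤-trans (+-mono-≤ (count-⊎ m (split ∘ (one ∷_))) (count-⊎ m (split ∘ (two ∷_))))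
          (≤-reflexive (interchange (count m (Q ∘ (one ∷_))) (count m (R ∘ (one ∷_))) _ _))

satisfiable? : ∀ m (P : Vec Letter m → Bool) → (∃[ b ] P b ≡ true) ⊎ (∀ b → P b ≡ false)
satisfiable? zero P with P [] in P[]
... | true  = inj₁ ([] , P[])
... | false = inj₂ λ { [] → P[] }
satisfiable? (suc m) P with satisfiable? m (P ∘ (one ∷_)) | satisfiable? m (P ∘ (two ∷_))
... | inj₁ (b , Pb) | _             = inj₁ (one ∷ b , Pb)
... | inj₂ _        | inj₁ (b , Pb) = inj₁ (two ∷ b , Pb)
... | inj₂ none₁    | inj₂ none₂    = inj₂ λ { (one ∷ b) → none₁ b ; (two ∷ b) → none₂ b }

count-unique : ∀ m {P} → (∀ b b′ → P b ≡ true → P b′ ≡ true → b ≡ b′) → count m P ≤ 1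
count-unique zero {P} _ with P []
... | true  = ≤-refl
... | false = z≤n
count-unique (suc m) {P} unique with satisfiable? m (P ∘ (one ∷_))
... | inj₁ (b₁ , Pb₁) = begin
    count m P₁ + count m P₂   ≡⟨ cong (count m P₁ +_) (count-none m none₂) ⟩
    count m P₁ + 0            ≡⟨ +-identityʳ _ ⟩
    count m P₁                ≤⟨ count-unique m (λ b b′ e e′ → Vec.∷-injectiveʳ (unique _ _ e e′)) ⟩
    1                         ∎
  where
    open ≤-Reasoning
    P₁ = P ∘ (one ∷_)
    P₂ = P ∘ (two ∷_)
    none₂ : ∀ b → P₂ b ≡ false
    none₂ b = ¬-not λ Pb → one∷≢two∷ (unique _ _ Pb₁ Pb)
      where one∷≢two∷ : one ∷ b₁ ≢ two ∷ b
            one∷≢two∷ ()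
... | inj₂ none₁ = subst (_≤ 1) (sym (cong (_+ count m (P ∘ (two ∷_))) (count-none m none₁)))
                         (count-unique m (λ b b′ e e′ → Vec.∷-injectiveʳ (unique _ _ e e′)))

count-dichotomy : ∀ m {P Q R} → (∀ b → P b ≡ true → Q b ≡ true ⊎ R b ≡ true) →
                  (∀ b b′ → P b ≡ true → Q b ≡ true → R b′ ≡ true → ⊥) →
                  count m P ≤ count m Q ⊎ count m P ≤ count m R
count-dichotomy m {P} {Q} split clash with satisfiable? m (λ b → P b ∧ Q b)
... | inj₁ (b₀ , PQb₀) = inj₁ (count-mono m λ b Pb →
        [ id , ⊥-elim ∘ clash b₀ b (∧-conicalˡ _ _ PQb₀) (∧-conicalʳ _ _ PQb₀) ] (split b Pb))
... | inj₂ none = inj₂ (count-mono m λ b Pb →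
        [ (λ Qb → ⊥-elim (not-¬ (cong₂ _∧_ Pb Qb) (none b))) , id ] (split b Pb))

-- The size bound

module SizeBound {I : ℕ → Set} (I-pos : ∀ k → I k → 1 ≤ k) {h} (ℓ∉I : ¬ I (suc h)) (m : ℕ) where

  open Construction h

  separated-□ : ∀ {F n} pol a → Congruent F → (∀ w d → count m (Separates pol F w d) ≤ n) →
                ∀ w d → count m (Separates pol (□ a F) w d) ≤ n
  separated-□ pol a F-cong IH w zero    = ≤-trans (≤-reflexive (count-none m λ _ → refl)) z≤n
  separated-□ pol a F-cong IH w (suc d) =
    ≤-trans (count-mono m λ b sep → trans (sym (Separates-at F-cong pol w (a ∷ []) d b)) sep)
            (IH (w ++ a ∷ []) d)

  -- By □A-blind-at-divergence, all b separated by [A_K] F at w are separated by F along one branch.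
  separated-□A : ∀ {F n} pol {k} → suc k ≢ ℓ → Congruent F → (∀ w d → count m (Separates pol F w d) ≤ n) →
                 ∀ w d → count m (Separates pol (□A (suc k) F) w d) ≤ n
  separated-□A {F} pol {k} K≢ℓ F-cong IH w d with suc k ≤? d
  ... | no K≰d = ≤-trans (≤-reflexive (count-none m λ b →
                   cong₂ _≻_ (□A-vacuous F _ (≰⇒> K≰d)) (□A-vacuous F _ (≰⇒> K≰d)))) z≤n
  ... | yes K≤d with count-dichotomy m split clash
    where
      K = suc k
      c = lead pol
      split : ∀ b → Separates pol (□A K F) w d b ≡ true →
              Separates pol F (w ++ alt c K) (d ∸ K) b ≡ true ⊎
              Separates pol F (w ++ alt (other c) K) (d ∸ K) b ≡ true
      split b sep with ≻-∧ (x pol c) (x pol (other c)) (x (opposite pol) c) (x (opposite pol) (other c))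
                           (trans (sym (cong₂ _≻_ (□A-unfold c F (val pol b at w) K≤d)
                                                  (□A-unfold c F (val (opposite pol) b at w) K≤d))) sep)
        where x : Polarity → Letter → Bool
              x pol′ c′ = F (val pol′ b at w at alt c′ K) (d ∸ K)
      ... | inj₁ sep₁ = inj₁ (trans (sym (Separates-at F-cong pol w (alt c K) (d ∸ K) b)) sep₁)
      ... | inj₂ sep₂ = inj₂ (trans (sym (Separates-at F-cong pol w (alt (other c) K) (d ∸ K) b)) sep₂)
      clash : ∀ b b′ → Separates pol (□A K F) w d b ≡ true → Separates pol F (w ++ alt c K) (d ∸ K) b ≡ true →
              Separates pol F (w ++ alt (other c) K) (d ∸ K) b′ ≡ true → ⊥
      clash b b′ sep sep₁ sep₂ =
        not-¬ sep (□A-blind-at-divergence F-cong pol {d = d} b b′ w K≢ℓ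
                     (Separates⇒≼target F-cong pol _ _ b sep₁) (Separates⇒≼target F-cong pol _ _ b′ sep₂))
  ...   | inj₁ through₁ = ≤-trans through₁ (IH _ _)
  ...   | inj₂ through₂ = ≤-trans through₂ (IH _ _)

  separated≤size : ∀ pol (φ : Form I) w d → count m (Separates pol ⟦ φ ⟧ w d) ≤ size φ
  separated≤size pos (var zero) w d = ≤-trans (count-mono m at-target) (count-unique m target-unique)
    where
      u = w ++ []
      at-target : ∀ b → Separates pos rootLabel w d b ≡ true → u == target b ≡ true
      at-target b = ≻-≻-true (A b u) (u == target b)
      target-unique : ∀ b b′ → u == target b ≡ true → u == target b′ ≡ true → b ≡ b′
      target-unique b b′ e e′ = target-injective (trans (sym (==-sound {u} e)) (==-sound e′))
  separated≤size neg (var zero) w d =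
    ≤-trans (≤-reflexive (count-none m λ b → ≻-≻-false (A b (w ++ [])) (w ++ [] == target b))) z≤n
  separated≤size pol (var (suc _)) w d = ≤-trans (≤-reflexive (count-none m λ _ → refl)) z≤n
  separated≤size pol (neg φ) w d =
    m≤n⇒m≤1+n (≤-trans (count-mono m λ b sep → trans (sym (Separates-not pol ⟦ φ ⟧ w d b)) sep)
                       (separated≤size (opposite pol) φ w d))
  separated≤size pol (or φ χ) w d =
    m≤n⇒m≤1+n (≤-trans (count-⊎ m λ b → ≻-∨ (x φ pol b) (x χ pol b) (x φ pol′ b) (x χ pol′ b))
                       (+-mono-≤ (separated≤size pol φ w d) (separated≤size pol χ w d)))
    where
      pol′ = opposite pol
      x : Form I → Polarity → Vec Letter m → Bool
      x ψ pol″ b = ⟦ ψ ⟧ (val pol″ b at w) d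
  separated≤size pol (boxAk zero k∈I φ) w d with I-pos zero k∈I
  ... | ()
  separated≤size pol (boxAk (suc k) k∈I φ) w d =
    m≤n⇒m≤1+n (separated-□A pol (λ e → ℓ∉I (subst I e k∈I)) (⟦⟧-cong φ) (separated≤size pol φ) w d)
  separated≤size pol (box₁ φ) w d = m≤n⇒m≤1+n (separated-□ pol one (⟦⟧-cong φ) (separated≤size pol φ) w d)
  separated≤size pol (box₂ φ) w d = m≤n⇒m≤1+n (separated-□ pol two (⟦⟧-cong φ) (separated≤size pol φ) w d)

theorem9 : (I : ℕ → Set) → (∀ k → I k → 1 ≤ k) →
           (ℓ : ℕ) → 1 ≤ ℓ → ¬ I ℓ →
           (i : ℕ) → 1 ≤ i → (m : ℕ) → i ≡ 2 * m →
           (ψ : Form I) →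
           (∀ (n : ℕ) (M : Model n) (w : Fin n) → sat M ψ w ≡ iterA M ℓ i (Π M p) w) →
           2 ^ m ≤ size ψ
theorem9 I I-pos (suc h) _ ℓ∉I .(2 * m) _ m refl ψ ψ≡ = begin
  2 ^ m                                ≡⟨ count-all m ⟨
  count m (λ _ → true)                 ≤⟨ count-mono m (λ b _ → ψ-separates b) ⟩
  count m (Separates pos ⟦ ψ ⟧ [] N)   ≤⟨ SizeBound.separated≤size I-pos ℓ∉I m pos ψ [] N ⟩
  size ψ                               ∎
  where
    open ≤-Reasoning
    open Construction h
    N = 2 * m * ℓ
    ψ-tree = tree-equivalence ψ ℓ (2 * m) ψ≡
    ψ-separates : ∀ b → Separates pos ⟦ ψ ⟧ [] N b ≡ true
    ψ-separates b = cong₂ _≻_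
      (trans (ψ-tree (A b) N) (□A-iter-true ℓ (2 * m) (A b) N λ s bs → cong not (Z-blocks b bs)))
      (trans (ψ-tree (B b) N) (□A-iter-false (B b) (target-blocks b) (B-target b) ≤-refl))
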